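{- Let $n\ge 1$ and let $T\in\mathcal{F}_n$ with $\mathrm{seq}(T)=(t_1,\ldots,t_n)$. Then $$\mathrm{rank}_n(T)=\sum_{i=1}^n F_{i-1}\,\chi(t_i=2).$$
   Context: Fibonacci numbers: $F_0=0$, $F_1=1$, $F_m=F_{m-1}+F_{m-2}$ for $m\ge 2$. For $n\ge1$, $\mathcal{F}_n$ is the set of tilings of a column of height $n$ (levels $1,\dots,n$ numbered from the bottom) by tiles of height $1$ and $2$ such that the bottom-most tile has height $1$; $|\mathcal{F}_n|=F_n$. For $T\in\mathcal{F}_n$, $\mathrm{seq}(T)=(t_1,\dots,t_n)$ where $t_i=1$ if a tile of height 1 has its top at level $i$, $t_i=2$ if a tile of height 2 has its top at level $i$, and $t_i=0$ if no tile has its top at level $i$. The Fibonacci tree for $F_n$ is obtained by reading each tiling from the top of the column downward, branching left at a tile of height 1 and right at a tile of height 2; equivalently, for distinct $T,T'\in\mathcal{F}_n$, $T'$ lies to the left of $T$ if, reading tiles from the top down, at the first place where the two tilings differ $T'$ has a tile of height 1 and $T$ has a tile of height 2. $\mathrm{rank}_n(T)$ is the number of $T'\in\mathcal{F}_n$ lying to the left of $T$ in this tree. $\chi(A)=1$ if statement $A$ is true and $0$ otherwise. -}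

module Defs where

open import Data.Nat using (ℕ; zero; suc; _+_; _*_; _≟_)
open import Data.Bool using (Bool; true; false; if_then_else_)
open import Data.List using (List; []; _∷_; _++_; map; length; filter)
open import Data.Vec using (Vec; []; _∷_; _∷ʳ_)
open import Relation.Nullary.Decidable using (⌊_⌋)
open import Relation.Binary.PropositionalEquality using (_≡_)
open import Data.Bool.Properties using (T?)

fib : ℕ → ℕ
fib zero = 0
fib (suc zero) = 1
fib (suc (suc m)) = fib (suc m) + fib m

-- Tilings of a column of height n by tiles of height 1 and 2 whose
-- bottom-most tile has height 1.  A tiling is built from the bottom up:
--   base   : the bottom tile (height 1), occupying level 1
--   add1 T : T with a tile of height 1 placed on top
--   add2 T : T with a tile of height 2 placed on top
-- So the outermost constructor is the TOP tile of the column.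
data Tiling : ℕ → Set where
  base : Tiling 1
  add1 : ∀ {n} → Tiling n → Tiling (suc n)
  add2 : ∀ {n} → Tiling n → Tiling (suc (suc n))

seq : ∀ {n} → Tiling n → Vec ℕ n
seq base = 1 ∷ []
seq (add1 T) = seq T ∷ʳ 1
seq (add2 T) = (seq T ∷ʳ 0) ∷ʳ 2

allTilings : (n : ℕ) → List (Tiling n)
allTilings zero = []
allTilings (suc zero) = base ∷ []
allTilings (suc (suc n)) = map add1 (allTilings (suc n)) ++ map add2 (allTilings n)

-- isLeft T' T = true iff T' lies to the left of T in the Fibonacci tree:
-- reading tiles from the top down, at the first place where they differ,
-- T' has a tile of height 1 and T a tile of height 2.
isLeft : ∀ {n} → Tiling n → Tiling n → Bool
isLeft base base = false
isLeft (add1 T') (add1 T) = isLeft T' T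
isLeft (add2 T') (add2 T) = isLeft T' T
isLeft (add1 T') (add2 T) = true
isLeft (add2 T') (add1 T) = false
isLeft base (add1 ())
isLeft (add1 ()) base

rank : ∀ {n} → Tiling n → ℕ
rank {n} T = length (filter (λ T' → T? (isLeft T' T)) (allTilings n))

χ≡2 : ℕ → ℕ
χ≡2 x = if ⌊ x ≟ 2 ⌋ then 1 else 0

-- Split F_n by the top tile: the F_{n-1} tilings ending in a tile of height 1
-- all lie to the left of those ending in a tile of height 2, and within each
-- group the order is that of F_{n-1}, resp. F_{n-2}.  Hence rank (add1 T) =
-- rank T and rank (add2 T) = F_{n-1} + rank T, which is exactly how the sum
-- changes when seq T is extended by 1, resp. by 0 and 2.
module Submission where

open import Defs
open import Data.Nat using (ℕ; _≤_; _*_; _+_; zero; suc)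
open import Data.Nat.Properties using (+-identityʳ; *-identityʳ; *-zeroʳ; +-assoc; +-comm)
open import Data.Fin using (toℕ)
open import Data.Vec using (Vec; []; _∷_; _∷ʳ_; sum; tabulate; lookup)
open import Data.List using (List; []; _∷_; _++_; map; length; filter)
open import Data.List.Properties using (length-++; length-map; filter-++; filter-all; filter-none)
open import Data.List.Relation.Unary.All using (universal)
open import Data.List.Relation.Unary.All.Properties using (map⁺)
open import Data.Bool using (true; false) renaming (T to True)
open import Data.Bool.Properties using (T?)
open import Data.Unit using (tt)
open import Function using (_∘_)
open import Level using (Level)
open import Relation.Nullary using (does)
open import Relation.Unary using (Pred; Decidable)
open import Relation.Binary.PropositionalEquality using (_≡_; refl; sym; trans; cong; cong₂; module ≡-Reasoning)
open ≡-Reasoning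

module _ {b p : Level} {B : Set b} {P : Pred B p} (P? : Decidable P) where

  filter-map : ∀ {a} {A : Set a} (f : A → B) (xs : List A) → filter P? (map f xs) ≡ map f (filter (P? ∘ f) xs)
  filter-map f [] = refl
  filter-map f (x ∷ xs) with does (P? (f x))
  ... | true = cong (f x ∷_) (filter-map f xs)
  ... | false = filter-map f xs

  length-filter-map : ∀ {a} {A : Set a} (f : A → B) (xs : List A) → length (filter P? (map f xs)) ≡ length (filter (P? ∘ f) xs)
  length-filter-map f xs = trans (cong length (filter-map f xs)) (length-map f (filter (P? ∘ f) xs))

  length-filter-++ : (xs ys : List B) → length (filter P? (xs ++ ys)) ≡ length (filter P? xs) + length (filter P? ys)
  length-filter-++ xs ys = trans (cong length (filter-++ P? xs ys)) (length-++ (filter P? xs))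

length-allTilings : ∀ n → length (allTilings n) ≡ fib n
length-allTilings zero = refl
length-allTilings (suc zero) = refl
length-allTilings (suc (suc n)) = begin
  length (map add1 (allTilings (suc n)) ++ map add2 (allTilings n))
    ≡⟨ length-++ (map add1 (allTilings (suc n))) ⟩
  length (map add1 (allTilings (suc n))) + length (map add2 (allTilings n))
    ≡⟨ cong₂ _+_ (length-map add1 (allTilings (suc n))) (length-map add2 (allTilings n)) ⟩
  length (allTilings (suc n)) + length (allTilings n)
    ≡⟨ cong₂ _+_ (length-allTilings (suc n)) (length-allTilings n) ⟩
  fib (suc n) + fib n ∎

isLeftOf? : ∀ {n} (T : Tiling n) → Decidable (λ T' → True (isLeft T' T))
isLeftOf? T T' = T? (isLeft T' T)

rank-add1 : ∀ {n} (T : Tiling (suc n)) → rank (add1 T) ≡ rank T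
rank-add1 {n} T = begin
  rank (add1 T)
    ≡⟨ length-filter-++ L (map add1 xs) (map add2 ys) ⟩
  length (filter L (map add1 xs)) + length (filter L (map add2 ys))
    ≡⟨ cong (λ zs → length (filter L (map add1 xs)) + length zs) (filter-none L (map⁺ (universal (λ _ ()) ys))) ⟩
  length (filter L (map add1 xs)) + 0
    ≡⟨ +-identityʳ _ ⟩
  length (filter L (map add1 xs))
    ≡⟨ length-filter-map L add1 xs ⟩
  rank T ∎
  where
  L : Decidable (λ T' → True (isLeft T' (add1 T)))
  L = isLeftOf? (add1 T)
  xs : List (Tiling (suc n))
  xs = allTilings (suc n)
  ys : List (Tiling n)
  ys = allTilings n

rank-add2 : ∀ {n} (T : Tiling n) → rank (add2 T) ≡ fib (suc n) + rank T
rank-add2 {n} T = begin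
  rank (add2 T)
    ≡⟨ length-filter-++ L (map add1 xs) (map add2 ys) ⟩
  length (filter L (map add1 xs)) + length (filter L (map add2 ys))
    ≡⟨ cong₂ _+_ (cong length (filter-all L (map⁺ (universal (λ _ → tt) xs)))) (length-filter-map L add2 ys) ⟩
  length (map add1 xs) + rank T
    ≡⟨ cong (_+ rank T) (trans (length-map add1 xs) (length-allTilings (suc n))) ⟩
  fib (suc n) + rank T ∎
  where
  L : Decidable (λ T' → True (isLeft T' (add2 T)))
  L = isLeftOf? (add2 T)
  xs : List (Tiling (suc n))
  xs = allTilings (suc n)
  ys : List (Tiling n)
  ys = allTilings n

weightOfTwos : ∀ {n} → (ℕ → ℕ) → Vec ℕ n → ℕ
weightOfTwos f v = sum (tabulate (λ i → f (toℕ i) * χ≡2 (lookup v i)))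

weightOfTwos-∷ʳ : ∀ {n} (f : ℕ → ℕ) (v : Vec ℕ n) x → weightOfTwos f (v ∷ʳ x) ≡ weightOfTwos f v + f n * χ≡2 x
weightOfTwos-∷ʳ f [] x = +-identityʳ _
weightOfTwos-∷ʳ f (y ∷ v) x = begin
  f 0 * χ≡2 y + weightOfTwos (f ∘ suc) (v ∷ʳ x)
    ≡⟨ cong (f 0 * χ≡2 y +_) (weightOfTwos-∷ʳ (f ∘ suc) v x) ⟩
  f 0 * χ≡2 y + (weightOfTwos (f ∘ suc) v + f (suc _) * χ≡2 x)
    ≡⟨ sym (+-assoc (f 0 * χ≡2 y) _ _) ⟩
  weightOfTwos f (y ∷ v) + f (suc _) * χ≡2 x ∎

weightOfTwos-∷ʳ-non2 : ∀ {n} (f : ℕ → ℕ) (v : Vec ℕ n) x → χ≡2 x ≡ 0 → weightOfTwos f (v ∷ʳ x) ≡ weightOfTwos f v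
weightOfTwos-∷ʳ-non2 {n} f v x χx≡0 = begin
  weightOfTwos f (v ∷ʳ x)       ≡⟨ weightOfTwos-∷ʳ f v x ⟩
  weightOfTwos f v + f n * χ≡2 x ≡⟨ cong (λ c → weightOfTwos f v + f n * c) χx≡0 ⟩
  weightOfTwos f v + f n * 0     ≡⟨ cong (weightOfTwos f v +_) (*-zeroʳ (f n)) ⟩
  weightOfTwos f v + 0           ≡⟨ +-identityʳ _ ⟩
  weightOfTwos f v ∎

weightOfTwos-∷ʳ-0-2 : ∀ {n} (f : ℕ → ℕ) (v : Vec ℕ n) → weightOfTwos f ((v ∷ʳ 0) ∷ʳ 2) ≡ f (suc n) + weightOfTwos f v
weightOfTwos-∷ʳ-0-2 {n} f v = begin
  weightOfTwos f ((v ∷ʳ 0) ∷ʳ 2)           ≡⟨ weightOfTwos-∷ʳ f (v ∷ʳ 0) 2 ⟩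
  weightOfTwos f (v ∷ʳ 0) + f (suc n) * 1  ≡⟨ cong₂ _+_ (weightOfTwos-∷ʳ-non2 f v 0 refl) (*-identityʳ (f (suc n))) ⟩
  weightOfTwos f v + f (suc n)             ≡⟨ +-comm (weightOfTwos f v) (f (suc n)) ⟩
  f (suc n) + weightOfTwos f v ∎

rank≡weightOfTwos : ∀ {n} (T : Tiling n) → rank T ≡ weightOfTwos fib (seq T)
rank≡weightOfTwos base = refl
rank≡weightOfTwos (add1 {suc n} T) = begin
  rank (add1 T)                      ≡⟨ rank-add1 T ⟩
  rank T                             ≡⟨ rank≡weightOfTwos T ⟩
  weightOfTwos fib (seq T)           ≡⟨ sym (weightOfTwos-∷ʳ-non2 fib (seq T) 1 refl) ⟩
  weightOfTwos fib (seq (add1 T)) ∎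
rank≡weightOfTwos (add2 {n} T) = begin
  rank (add2 T)                          ≡⟨ rank-add2 T ⟩
  fib (suc n) + rank T                   ≡⟨ cong (fib (suc n) +_) (rank≡weightOfTwos T) ⟩
  fib (suc n) + weightOfTwos fib (seq T) ≡⟨ sym (weightOfTwos-∷ʳ-0-2 fib (seq T)) ⟩
  weightOfTwos fib (seq (add2 T)) ∎

lemma1 : (n : ℕ) → 1 ≤ n → (T : Tiling n) →
    rank T ≡ sum (tabulate (λ i → fib (toℕ i) * χ≡2 (lookup (seq T) i)))
lemma1 n _ T = rank≡weightOfTwos T
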